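{- Suppose $Y\subset X=W_w(n,q)$ is an $(r,s)$-$(n,w,q,\lambda)$-design. If $r-s\ge n-w$, then $Y$ is a $(w,s)$-$(n,w,q,\lambda')$-design, where \[ \lambda'=\frac{1}{\binom{n-r}{w-r}}\lambda. \]
   Context: Let $q\ge 2$, $n\ge1$, $0\le w\le n$ be integers, $F=\{0,1,\ldots,q-1\}$, $\overline F=F\setminus\{0\}$, $N=\{1,\ldots,n\}$. For $x\in F^n$, $\overline x=\{i\mid x_i\ne0\}$; $X=W_w(n,q)$ is the set of $x\in F^n$ with $|\overline x|=w$. For $Y\subset X$, subsets $\mathcal{S}=\{i_1<\cdots<i_s\}\subset\mathcal{R}\subset N$ and $\omega\in\overline F^s$, put $m_{\mathcal R,\mathcal S}(Y,\omega)=|\{y\in Y\mid\mathcal R\subset\overline y,\ y_{i_j}=\omega_j\ (j=1,\ldots,s)\}|$. For integers $0\le s\le r\le w$, a subset $Y\subset X$ is an $(r,s)$-$(n,w,q,\lambda)$-design if $m_{\mathcal R,\mathcal S}(Y,\omega)=\lambda$ for all $\omega\in\overline F^s$ and all $\mathcal S\subset\mathcal R\subset N$ with $|\mathcal S|=s$, $|\mathcal R|=r$. -}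

module Defs where

open import Data.Nat using (ℕ; zero; suc)
open import Data.Bool using (Bool; true; false)
open import Data.Fin using (Fin; toℕ)
open import Data.Fin.Properties using (_≟_)
open import Data.Fin.Subset using (Subset; _⊆_; _∈_; ∣_∣)
open import Data.Fin.Subset.Properties using (_⊆?_; _∈?_)
open import Data.Vec using (Vec; lookup; toList)
import Data.Vec as V
open import Data.List using (List; length; filter; zip; allFin)
open import Data.List.Relation.Unary.All using (All; all?)
open import Data.List.Relation.Unary.Unique.Propositional using (Unique)
open import Data.Product using (_×_; _,_; proj₁; proj₂)
open import Relation.Binary.PropositionalEquality using (_≡_; _≢_)
open import Relation.Nullary.Decidable using (Dec; _×-dec_)

-- F = Fin q = {0,…,q-1}; a word x ∈ F^n is a Vec (Fin q) n (position i ∈ N = Fin n).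

isNonZero : ∀ {q} → Fin q → Bool
isNonZero a with toℕ a
... | zero  = false
... | suc _ = true

support : ∀ {n q} → Vec (Fin q) n → Subset n
support x = V.map isNonZero x

InW : ∀ {n q} (w : ℕ) → Vec (Fin q) n → Set
InW w x = ∣ support x ∣ ≡ w

NonZeroVec : ∀ {q s} → Vec (Fin q) s → Set
NonZeroVec ω = ∀ j → toℕ (lookup ω j) ≢ 0

elems : ∀ {n} → Subset n → List (Fin n)
elems S = filter (λ i → i ∈? S) (allFin _)

Matches : ∀ {n q s} → Subset n → Vec (Fin q) s → Vec (Fin q) n → Set
Matches S ω y = All (λ p → lookup y (proj₁ p) ≡ proj₂ p) (zip (elems S) (toList ω))

matches? : ∀ {n q s} (S : Subset n) (ω : Vec (Fin q) s) (y : Vec (Fin q) n) → Dec (Matches S ω y)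
matches? S ω y = all? (λ p → lookup y (proj₁ p) ≟ proj₂ p) (zip (elems S) (toList ω))

-- m_{R,S}(Y, ω) = |{ y ∈ Y | R ⊆ ȳ, y_{i_j} = ω_j }|, Y a duplicate-free list
m : ∀ {n q s} → Subset n → Subset n → List (Vec (Fin q) n) → Vec (Fin q) s → ℕ
m R S Y ω = length (filter (λ y → (R ⊆? support y) ×-dec matches? S ω y) Y)

IsDesign : ∀ {n q} (w r s lam : ℕ) → List (Vec (Fin q) n) → Set
IsDesign {n} {q} w r s lam Y =
  (R S : Subset n) → S ⊆ R → ∣ S ∣ ≡ s → ∣ R ∣ ≡ r →
  (ω : Vec (Fin q) s) → NonZeroVec ω → m R S Y ω ≡ lam

module Submission where

-- Fix positions S with |S| = s and nonzero values ω on them, let L be the words of Y that agree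
-- with ω on S, and for B ⊇ S let c(B) be the number of words in L whose support contains B.
-- Counting the pairs (a, y) with B ∪ {a} ⊆ supp y in two ways gives (w − j) c(B) = (n − j) c'
-- whenever |B| = j and c is constantly c' on the (j+1)-supersets of S; hence the design
-- condition at level r makes c constant on every level j ≤ r. A word y with B ⊆ supp y and
-- |B| = w has support exactly B, so inclusion–exclusion over the n − w points outside B writes
-- c(B) through the levels s, …, s + (n − w) ≤ r only: c is a constant ν(S, ω) on level w.
-- Running the same recurrence from level w back down to level r gives λ = ν(S, ω) C(n−r, w−r),
-- and as the binomial is positive, ν does not depend on S and ω either.

open import Defs
open import Data.Bool using (true; false; if_then_else_)
open import Data.Empty using (⊥-elim)
open import Data.Fin using (Fin; zero; suc; toℕ)
import Data.Fin.Properties as Fin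
open import Data.Fin.Subset using (Subset; _⊆_; _∈_; _∉_; ∣_∣; ⊤; ⊥; ⁅_⁆; _∪_; _-_; inside; outside)
open import Data.Fin.Subset.Properties
  using (_⊆?_; _∈?_; ∣p∣≤n; ∣⊥∣≡0; ∣⊤∣≡n; p⊆q⇒∣p∣≤∣q∣; p⊂q⇒∣p∣<∣q∣; ⊆-refl; ⊆-antisym; ⊆-max;
         p⊆p∪q; q⊆p∪q; p─q⊆p; x∈⁅x⁆; x∈⁅y⁆⇒x≡y; x∈p∪q⁻; ∪-identityʳ; p─⊥≡p; drop-there; x∈p∧x≢y⇒x∈p-y)
open import Data.List using (List; []; _∷_; length; filter)
open import Data.List.Properties using (filter-≐; filter-all; filter-none)
open import Data.List.Relation.Unary.All using (All; []; _∷_)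
import Data.List.Relation.Unary.All as All
open import Data.List.Relation.Unary.All.Properties using (all-filter; filter⁺)
open import Data.List.Relation.Unary.Unique.Propositional using (Unique)
open import Data.Nat using (ℕ; zero; suc; _+_; _*_; _∸_; _≤_; _<_; z≤n; s≤s; NonZero; >-nonZero)
open import Data.Nat.Combinatorics using (_C_; nCk+nC[k+1]≡[n+1]C[k+1]; nC1≡n)
open import Data.Nat.Combinatorics.Specification using (k>n⇒nCk≡0)
open import Data.Nat.Properties
open import Data.Product using (Σ; ∃; _×_; _,_; proj₁)
open import Data.Sum using (inj₁; inj₂)
open import Data.Vec using (Vec; []; _∷_; here; there; replicate)
open import Data.Vec.Properties using (lookup-replicate)
open import Function using (_∘_)
open import Level using (0ℓ)
open import Relation.Binary.PropositionalEquality
open import Relation.Nullary using (Dec; yes; no; ¬_; does)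
open import Relation.Nullary.Decidable using (_×-dec_; ¬?)
open import Relation.Unary using (Pred; Decidable)

open import Algebra.Properties.CommutativeSemigroup +-commutativeSemigroup
  using () renaming (x∙yz≈y∙xz to m+[n+o]≡n+[m+o])
open import Algebra.Properties.CommutativeSemigroup *-commutativeSemigroup
  using () renaming (x∙yz≈y∙xz to m*[n*o]≡n*[m*o])
open import Algebra.Properties.Semiring.Sum +-*-semiring
  using (sum-syntax; sum-cong-≗; ∑-distrib-+; sum-replicate-zero)

𝟙 : {P : Set} → Dec P → ℕ
𝟙 d = if does d then 1 else 0

𝟙-yes : {P : Set} (d : Dec P) → P → 𝟙 d ≡ 1
𝟙-yes (yes _) _ = refl
𝟙-yes (no ¬p) p = ⊥-elim (¬p p)

𝟙-no : {P : Set} (d : Dec P) → ¬ P → 𝟙 d ≡ 0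
𝟙-no (yes p) ¬p = ⊥-elim (¬p p)
𝟙-no (no _) _ = refl

module _ {A : Set} {P : Pred A 0ℓ} (P? : Decidable P) where

  length-filter-∷ : ∀ x xs → length (filter P? (x ∷ xs)) ≡ 𝟙 (P? x) + length (filter P? xs)
  length-filter-∷ x xs with does (P? x)
  ... | true = refl
  ... | false = refl

module _ {A : Set} {P Q : Pred A 0ℓ} (P? : Decidable P) (Q? : Decidable Q) where

  length-filter-filter : ∀ xs → length (filter P? (filter Q? xs)) ≡ length (filter (λ x → P? x ×-dec Q? x) xs)
  length-filter-filter [] = refl
  length-filter-filter (x ∷ xs) with does (Q? x)
  ... | false with does (P? x)
  ...   | true = length-filter-filter xs
  ...   | false = length-filter-filter xs
  length-filter-filter (x ∷ xs) | true with does (P? x)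
  ...   | true = cong suc (length-filter-filter xs)
  ...   | false = length-filter-filter xs

  length-filter-split : ∀ xs →
    length (filter P? xs) ≡ length (filter P? (filter (¬? ∘ Q?) xs)) + length (filter P? (filter Q? xs))
  length-filter-split [] = refl
  length-filter-split (x ∷ xs) with does (Q? x)
  ... | false with does (P? x)
  ...   | true = cong suc (length-filter-split xs)
  ...   | false = length-filter-split xs
  length-filter-split (x ∷ xs) | true with does (P? x)
  ...   | true = trans (cong suc (length-filter-split xs)) (sym (+-suc _ _))
  ...   | false = length-filter-split xs

∑-by-membership : ∀ {n} (p : Subset n) {f : Fin n → ℕ} {x y : ℕ} →
  (∀ a → a ∈ p → f a ≡ x) → (∀ a → a ∉ p → f a ≡ y) →
  ∑[ a < n ] f a ≡ ∣ p ∣ * x + (n ∸ ∣ p ∣) * y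
∑-by-membership [] _ _ = refl
∑-by-membership {suc n} (inside ∷ p) {f} {x} {y} fp f∉p = begin
  f zero + ∑[ a < n ] f (suc a)               ≡⟨ cong₂ _+_ (fp zero here) rest ⟩
  x + (∣ p ∣ * x + (n ∸ ∣ p ∣) * y)           ≡⟨ +-assoc x _ _ ⟨
  suc ∣ p ∣ * x + (n ∸ ∣ p ∣) * y             ∎
  where
  open ≡-Reasoning
  rest : ∑[ a < n ] f (suc a) ≡ ∣ p ∣ * x + (n ∸ ∣ p ∣) * y
  rest = ∑-by-membership p (λ a → fp (suc a) ∘ there) (λ a a∉p → f∉p (suc a) (a∉p ∘ drop-there))
∑-by-membership {suc n} (outside ∷ p) {f} {x} {y} fp f∉p = begin
  f zero + ∑[ a < n ] f (suc a)               ≡⟨ cong₂ _+_ (f∉p zero λ ()) rest ⟩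
  y + (∣ p ∣ * x + (n ∸ ∣ p ∣) * y)           ≡⟨ m+[n+o]≡n+[m+o] y (∣ p ∣ * x) _ ⟩
  ∣ p ∣ * x + (suc (n ∸ ∣ p ∣)) * y           ≡⟨ cong (λ k → ∣ p ∣ * x + k * y) (+-∸-assoc 1 (∣p∣≤n p)) ⟨
  ∣ p ∣ * x + (suc n ∸ ∣ p ∣) * y             ∎
  where
  open ≡-Reasoning
  rest : ∑[ a < n ] f (suc a) ≡ ∣ p ∣ * x + (n ∸ ∣ p ∣) * y
  rest = ∑-by-membership p (λ a → fp (suc a) ∘ there) (λ a a∉p → f∉p (suc a) (a∉p ∘ drop-there))

x∉p⇒∣p∪⁅x⁆∣≡1+∣p∣ : ∀ {n} {x : Fin n} {p : Subset n} → x ∉ p → ∣ p ∪ ⁅ x ⁆ ∣ ≡ suc ∣ p ∣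
x∉p⇒∣p∪⁅x⁆∣≡1+∣p∣ {x = zero} {inside ∷ p} x∉p = ⊥-elim (x∉p here)
x∉p⇒∣p∪⁅x⁆∣≡1+∣p∣ {x = zero} {outside ∷ p} _ = cong (suc ∘ ∣_∣) (∪-identityʳ p)
x∉p⇒∣p∪⁅x⁆∣≡1+∣p∣ {x = suc x} {inside ∷ p} x∉p = cong suc (x∉p⇒∣p∪⁅x⁆∣≡1+∣p∣ (x∉p ∘ there))
x∉p⇒∣p∪⁅x⁆∣≡1+∣p∣ {x = suc x} {outside ∷ p} x∉p = x∉p⇒∣p∪⁅x⁆∣≡1+∣p∣ (x∉p ∘ there)

x∈p⇒1+∣p-x∣≡∣p∣ : ∀ {n} {x : Fin n} {p : Subset n} → x ∈ p → suc ∣ p - x ∣ ≡ ∣ p ∣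
x∈p⇒1+∣p-x∣≡∣p∣ {x = zero} {inside ∷ p} _ = cong (suc ∘ ∣_∣) (p─⊥≡p p)
x∈p⇒1+∣p-x∣≡∣p∣ {x = suc x} {inside ∷ p} x∈p = cong suc (x∈p⇒1+∣p-x∣≡∣p∣ (drop-there x∈p))
x∈p⇒1+∣p-x∣≡∣p∣ {x = suc x} {outside ∷ p} x∈p = x∈p⇒1+∣p-x∣≡∣p∣ (drop-there x∈p)

x∉p-x : ∀ {n} (x : Fin n) (p : Subset n) → x ∉ p - x
x∉p-x zero (_ ∷ p) ()
x∉p-x (suc x) (_ ∷ p) x∈p-x = x∉p-x x p (drop-there x∈p-x)

p⊆q∧x∉p⇒p⊆q-x : ∀ {n} {x : Fin n} {p q : Subset n} → p ⊆ q → x ∉ p → p ⊆ q - x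
p⊆q∧x∉p⇒p⊆q-x p⊆q x∉p y∈p = x∈p∧x≢y⇒x∈p-y (p⊆q y∈p) λ { refl → x∉p y∈p }

p∪⁅x⁆⊆q⇒p⊆q : ∀ {n} {x : Fin n} {p q : Subset n} → p ∪ ⁅ x ⁆ ⊆ q → p ⊆ q
p∪⁅x⁆⊆q⇒p⊆q {x = x} p∪x⊆q = p∪x⊆q ∘ p⊆p∪q ⁅ x ⁆

p∪⁅x⁆⊆q⇒x∈q : ∀ {n} {x : Fin n} {p q : Subset n} → p ∪ ⁅ x ⁆ ⊆ q → x ∈ q
p∪⁅x⁆⊆q⇒x∈q {x = x} {p} p∪x⊆q = p∪x⊆q (q⊆p∪q p ⁅ x ⁆ (x∈⁅x⁆ x))

p⊆q∧x∈q⇒p∪⁅x⁆⊆q : ∀ {n} {x : Fin n} {p q : Subset n} → p ⊆ q → x ∈ q → p ∪ ⁅ x ⁆ ⊆ q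
p⊆q∧x∈q⇒p∪⁅x⁆⊆q {x = x} {p} p⊆q x∈q y∈p∪x with x∈p∪q⁻ p ⁅ x ⁆ y∈p∪x
... | inj₁ y∈p = p⊆q y∈p
... | inj₂ y∈x rewrite x∈⁅y⁆⇒x≡y x y∈x = x∈q

x∈p⇒p∪⁅x⁆≡p : ∀ {n} {x : Fin n} {p : Subset n} → x ∈ p → p ∪ ⁅ x ⁆ ≡ p
x∈p⇒p∪⁅x⁆≡p {x = x} x∈p = ⊆-antisym (p⊆q∧x∈q⇒p∪⁅x⁆⊆q ⊆-refl x∈p) (p⊆p∪q ⁅ x ⁆)

p⊆q∧∣q∣≤∣p∣⇒p≡q : ∀ {n} {p q : Subset n} → p ⊆ q → ∣ q ∣ ≤ ∣ p ∣ → p ≡ q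
p⊆q∧∣q∣≤∣p∣⇒p≡q {p = p} {q} p⊆q ∣q∣≤∣p∣ = ⊆-antisym p⊆q q⊆p
  where
  q⊆p : q ⊆ p
  q⊆p {x} x∈q with x ∈? p
  ... | yes x∈p = x∈p
  ... | no x∉p = ⊥-elim (<⇒≱ (p⊂q⇒∣p∣<∣q∣ (p⊆q , x , x∈q , x∉p)) ∣q∣≤∣p∣)

∣p∣<∣q∣⇒∃q∖p : ∀ {n} {p q : Subset n} → ∣ p ∣ < ∣ q ∣ → ∃ λ x → x ∈ q × x ∉ p
∣p∣<∣q∣⇒∃q∖p {p = p} {q} ∣p∣<∣q∣ with Fin.any? (λ x → (x ∈? q) ×-dec (¬? (x ∈? p)))
... | yes q∖p = q∖p
... | no ∄q∖p = ⊥-elim (<⇒≱ ∣p∣<∣q∣ (p⊆q⇒∣p∣≤∣q∣ q⊆p))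
  where
  q⊆p : q ⊆ p
  q⊆p {x} x∈q with x ∈? p
  ... | yes x∈p = x∈p
  ... | no x∉p = ⊥-elim (∄q∖p (x , x∈q , x∉p))

∑-𝟙-p∪⁅a⁆⊆q : ∀ {n} (p q : Subset n) → ∑[ a < n ] 𝟙 (p ∪ ⁅ a ⁆ ⊆? q) ≡ 𝟙 (p ⊆? q) * ∣ q ∣
∑-𝟙-p∪⁅a⁆⊆q {n} p q with p ⊆? q
... | yes p⊆q = begin
  ∑[ a < n ] 𝟙 (p ∪ ⁅ a ⁆ ⊆? q)   ≡⟨ ∑-by-membership q (λ a a∈q → 𝟙-yes (p ∪ ⁅ a ⁆ ⊆? q) (p⊆q∧x∈q⇒p∪⁅x⁆⊆q p⊆q a∈q))
                                                    (λ a a∉q → 𝟙-no (p ∪ ⁅ a ⁆ ⊆? q) (a∉q ∘ p∪⁅x⁆⊆q⇒x∈q)) ⟩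
  ∣ q ∣ * 1 + (n ∸ ∣ q ∣) * 0       ≡⟨ cong₂ _+_ (*-identityʳ ∣ q ∣) (*-zeroʳ (n ∸ ∣ q ∣)) ⟩
  ∣ q ∣ + 0                         ∎
  where open ≡-Reasoning
... | no p⊈q = trans (sum-cong-≗ (λ a → 𝟙-no (p ∪ ⁅ a ⁆ ⊆? q) (p⊈q ∘ p∪⁅x⁆⊆q⇒p⊆q))) (sum-replicate-zero n)

enlarge : ∀ {n} → ℕ → Subset n → Subset n
enlarge zero p = p
enlarge (suc k) [] = []
enlarge (suc k) (inside ∷ p) = inside ∷ enlarge (suc k) p
enlarge (suc k) (outside ∷ p) = inside ∷ enlarge k p

p⊆enlarge : ∀ {n} k (p : Subset n) → p ⊆ enlarge k p
p⊆enlarge zero p x∈p = x∈p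
p⊆enlarge (suc k) (inside ∷ p) here = here
p⊆enlarge (suc k) (inside ∷ p) (there x∈p) = there (p⊆enlarge (suc k) p x∈p)
p⊆enlarge (suc k) (outside ∷ p) (there x∈p) = there (p⊆enlarge k p x∈p)

∣enlarge∣≡∣p∣+k : ∀ {n} k (p : Subset n) → ∣ p ∣ + k ≤ n → ∣ enlarge k p ∣ ≡ ∣ p ∣ + k
∣enlarge∣≡∣p∣+k zero p _ = sym (+-identityʳ _)
∣enlarge∣≡∣p∣+k (suc k) [] ()
∣enlarge∣≡∣p∣+k (suc k) (inside ∷ p) (s≤s h) = cong suc (∣enlarge∣≡∣p∣+k (suc k) p h)
∣enlarge∣≡∣p∣+k {suc n} (suc k) (outside ∷ p) h =
  trans (cong suc (∣enlarge∣≡∣p∣+k k p (≤-pred (subst (_≤ suc n) (+-suc ∣ p ∣ k) h)))) (sym (+-suc ∣ p ∣ k))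

[k+1]*[n+1]C[k+1]≡[n+1]*nCk : ∀ n k → suc k * (suc n C suc k) ≡ suc n * (n C k)
[k+1]*[n+1]C[k+1]≡[n+1]*nCk zero zero = refl
[k+1]*[n+1]C[k+1]≡[n+1]*nCk zero (suc k) =
  trans (cong (suc (suc k) *_) (k>n⇒nCk≡0 {1} {2 + k} (s≤s (s≤s z≤n))))
    (trans (*-zeroʳ (suc (suc k))) (sym (k>n⇒nCk≡0 {0} {1 + k} (s≤s z≤n))))
[k+1]*[n+1]C[k+1]≡[n+1]*nCk (suc n) zero = trans (*-identityˡ _) (trans (nC1≡n (suc (suc n))) (sym (*-identityʳ _)))
[k+1]*[n+1]C[k+1]≡[n+1]*nCk (suc n) (suc k) = begin
  (2 + k) * ((2 + n) C (2 + k))  ≡⟨ cong ((2 + k) *_) (nCk+nC[k+1]≡[n+1]C[k+1] (suc n) (suc k)) ⟨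
  (2 + k) * (X + Y)              ≡⟨ *-distribˡ-+ (2 + k) X Y ⟩
  X + (1 + k) * X + (2 + k) * Y  ≡⟨ cong₂ (λ u v → X + u + v) ([k+1]*[n+1]C[k+1]≡[n+1]*nCk n k) ([k+1]*[n+1]C[k+1]≡[n+1]*nCk n (suc k)) ⟩
  X + (1 + n) * Z + (1 + n) * W  ≡⟨ +-assoc X ((1 + n) * Z) ((1 + n) * W) ⟩
  X + ((1 + n) * Z + (1 + n) * W) ≡⟨ cong (X +_) (*-distribˡ-+ (1 + n) Z W) ⟨
  X + (1 + n) * (Z + W)          ≡⟨ cong (λ t → X + (1 + n) * t) (nCk+nC[k+1]≡[n+1]C[k+1] n k) ⟩
  (2 + n) * X                    ∎
  where
  open ≡-Reasoning
  X = (1 + n) C (1 + k)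
  Y = (1 + n) C (2 + k)
  Z = n C k
  W = n C (1 + k)

k≤n⇒0<nCk : ∀ {n k} → k ≤ n → 0 < n C k
k≤n⇒0<nCk {n} {zero} _ = s≤s z≤n
k≤n⇒0<nCk {suc n} {suc k} (s≤s k≤n) =
  ≤-trans (k≤n⇒0<nCk k≤n) (≤-trans (m≤m+n (n C k) _) (≤-reflexive (nCk+nC[k+1]≡[n+1]C[k+1] n k)))

Δ : (ℕ → ℕ) → ℕ → ℕ
Δ f j = f j ∸ f (suc j)

Δ^ : ℕ → (ℕ → ℕ) → ℕ → ℕ
Δ^ zero f = f
Δ^ (suc d) f = Δ^ d (Δ f)

module SupersetCount {A : Set} {n : ℕ} (σ : A → Subset n) where

  count⊇ : Subset n → List A → ℕ
  count⊇ B L = length (filter (λ y → B ⊆? σ y) L)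

  SupportsOfSize : ℕ → List A → Set
  SupportsOfSize w = All (λ y → ∣ σ y ∣ ≡ w)

  UniformWithin : (K U : Subset n) (j μ : ℕ) → List A → Set
  UniformWithin K U j μ L = ∀ B → K ⊆ B → B ⊆ U → ∣ B ∣ ≡ j → count⊇ B L ≡ μ

  Uniform : (K : Subset n) (j μ : ℕ) → List A → Set
  Uniform K j μ L = ∀ B → K ⊆ B → ∣ B ∣ ≡ j → count⊇ B L ≡ μ

  ∑-count⊇-∪⁅a⁆ : ∀ {w} B L → SupportsOfSize w L → ∑[ a < n ] count⊇ (B ∪ ⁅ a ⁆) L ≡ w * count⊇ B L
  ∑-count⊇-∪⁅a⁆ {w} B [] [] = trans (sum-replicate-zero n) (sym (*-zeroʳ w))
  ∑-count⊇-∪⁅a⁆ {w} B (y ∷ L) (∣σy∣≡w ∷ allw) = begin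
    ∑[ a < n ] count⊇ (B ∪ ⁅ a ⁆) (y ∷ L)
      ≡⟨ sum-cong-≗ (λ a → length-filter-∷ (λ y → B ∪ ⁅ a ⁆ ⊆? σ y) y L) ⟩
    ∑[ a < n ] (𝟙 (B ∪ ⁅ a ⁆ ⊆? σ y) + count⊇ (B ∪ ⁅ a ⁆) L)
      ≡⟨ ∑-distrib-+ (λ a → 𝟙 (B ∪ ⁅ a ⁆ ⊆? σ y)) (λ a → count⊇ (B ∪ ⁅ a ⁆) L) ⟩
    ∑[ a < n ] 𝟙 (B ∪ ⁅ a ⁆ ⊆? σ y) + ∑[ a < n ] count⊇ (B ∪ ⁅ a ⁆) L
      ≡⟨ cong₂ _+_ (∑-𝟙-p∪⁅a⁆⊆q B (σ y)) (∑-count⊇-∪⁅a⁆ B L allw) ⟩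
    𝟙 (B ⊆? σ y) * ∣ σ y ∣ + w * count⊇ B L
      ≡⟨ cong (λ k → 𝟙 (B ⊆? σ y) * k + w * count⊇ B L) ∣σy∣≡w ⟩
    𝟙 (B ⊆? σ y) * w + w * count⊇ B L
      ≡⟨ cong (_+ w * count⊇ B L) (*-comm (𝟙 (B ⊆? σ y)) w) ⟩
    w * 𝟙 (B ⊆? σ y) + w * count⊇ B L
      ≡⟨ *-distribˡ-+ w (𝟙 (B ⊆? σ y)) (count⊇ B L) ⟨
    w * (𝟙 (B ⊆? σ y) + count⊇ B L)
      ≡⟨ cong (w *_) (length-filter-∷ (λ y → B ⊆? σ y) y L) ⟨
    w * count⊇ B (y ∷ L) ∎
    where open ≡-Reasoning

  count⊇-recurrence : ∀ {w K j μ B L} → SupportsOfSize w L → Uniform K (suc j) μ L → K ⊆ B → ∣ B ∣ ≡ j →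
    (w ∸ j) * count⊇ B L ≡ (n ∸ j) * μ
  count⊇-recurrence {w} {K} {j} {μ} {B} {L} allw unif K⊆B ∣B∣≡j = begin
    (w ∸ j) * count⊇ B L                             ≡⟨ *-distribʳ-∸ (count⊇ B L) w j ⟩
    w * count⊇ B L ∸ j * count⊇ B L                  ≡⟨ cong (_∸ j * count⊇ B L) double-count ⟩
    (j * count⊇ B L + (n ∸ j) * μ) ∸ j * count⊇ B L  ≡⟨ m+n∸m≡n (j * count⊇ B L) _ ⟩
    (n ∸ j) * μ                                      ∎
    where
    open ≡-Reasoning
    double-count : w * count⊇ B L ≡ j * count⊇ B L + (n ∸ j) * μ
    double-count = begin
      w * count⊇ B L                                 ≡⟨ ∑-count⊇-∪⁅a⁆ B L allw ⟨
      ∑[ a < n ] count⊇ (B ∪ ⁅ a ⁆) L                 ≡⟨ ∑-by-membership B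
                                                          (λ a a∈B → cong (λ D → count⊇ D L) (x∈p⇒p∪⁅x⁆≡p a∈B))
                                                          (λ a a∉B → unif (B ∪ ⁅ a ⁆) (p⊆p∪q ⁅ a ⁆ ∘ K⊆B)
                                                                          (trans (x∉p⇒∣p∪⁅x⁆∣≡1+∣p∣ a∉B) (cong suc ∣B∣≡j))) ⟩
      ∣ B ∣ * count⊇ B L + (n ∸ ∣ B ∣) * μ            ≡⟨ cong (λ i → i * count⊇ B L + (n ∸ i) * μ) ∣B∣≡j ⟩
      j * count⊇ B L + (n ∸ j) * μ                   ∎

  uniform-downward : ∀ {w K j μ D L} → SupportsOfSize w L → j < w → Uniform K (suc j) μ L →
    K ⊆ D → ∣ D ∣ ≡ j → Uniform K j (count⊇ D L) L
  uniform-downward {w} {j = j} allw j<w unif K⊆D ∣D∣≡j B K⊆B ∣B∣≡j =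
    *-cancelˡ-≡ _ _ (w ∸ j) {{>-nonZero (m<n⇒0<n∸m j<w)}}
      (trans (count⊇-recurrence allw unif K⊆B ∣B∣≡j) (sym (count⊇-recurrence allw unif K⊆D ∣D∣≡j)))

  uniform-below : ∀ {w K r μ L} → SupportsOfSize w L → r ≤ w → w ≤ n → Uniform K r μ L →
    ∀ D → K ⊆ D → ∣ D ∣ ≤ r → Uniform K ∣ D ∣ (count⊇ D L) L
  uniform-below {w} {K} {r} {μ} {L} allw r≤w w≤n unif D K⊆D ∣D∣≤r = go (r ∸ ∣ D ∣) D K⊆D (m+[n∸m]≡n ∣D∣≤r)
    where
    go : ∀ k D → K ⊆ D → ∣ D ∣ + k ≡ r → Uniform K ∣ D ∣ (count⊇ D L) L
    go zero D K⊆D ∣D∣≡r B K⊆B ∣B∣≡∣D∣ = trans (unif B K⊆B (trans ∣B∣≡∣D∣ ∣D∣≡r′)) (sym (unif D K⊆D ∣D∣≡r′))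
      where ∣D∣≡r′ = trans (sym (+-identityʳ ∣ D ∣)) ∣D∣≡r
    go (suc k) D K⊆D ∣D∣+k≡r = uniform-downward allw ∣D∣<w (subst (λ i → Uniform K i (count⊇ D′ L) L) ∣D′∣≡1+∣D∣ IH) K⊆D refl
      where
      ∣D∣<r : ∣ D ∣ < r
      ∣D∣<r = subst (suc ∣ D ∣ ≤_) (trans (sym (+-suc ∣ D ∣ k)) ∣D∣+k≡r) (m≤m+n (suc ∣ D ∣) k)
      ∣D∣<w : ∣ D ∣ < w
      ∣D∣<w = ≤-trans ∣D∣<r r≤w
      D′ = enlarge 1 D
      ∣D′∣≡1+∣D∣ : ∣ D′ ∣ ≡ suc ∣ D ∣
      ∣D′∣≡1+∣D∣ = trans (∣enlarge∣≡∣p∣+k 1 D (subst (_≤ n) (+-comm 1 ∣ D ∣) (≤-trans ∣D∣<w w≤n))) (+-comm ∣ D ∣ 1)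
      IH = go k D′ (p⊆enlarge 1 D ∘ K⊆D) (trans (cong (_+ k) ∣D′∣≡1+∣D∣) (trans (sym (+-suc ∣ D ∣ k)) ∣D∣+k≡r))

  uniform-binomial : ∀ {w K μ L} → SupportsOfSize w L → w ≤ n → Uniform K w μ L →
    ∀ j k → j + k ≡ w → Uniform K j (μ * ((n ∸ j) C k)) L
  uniform-binomial {μ = μ} allw w≤n unif j zero j+0≡w B K⊆B ∣B∣≡j =
    trans (unif B K⊆B (trans ∣B∣≡j (trans (sym (+-identityʳ j)) j+0≡w))) (sym (*-identityʳ μ))
  uniform-binomial {w} {K} {μ} {L} allw w≤n unif j (suc k) j+1+k≡w B K⊆B ∣B∣≡j =
    *-cancelˡ-≡ _ _ (suc k) (begin
      suc k * count⊇ B L                ≡⟨ cong (_* count⊇ B L) w∸j≡1+k ⟨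
      (w ∸ j) * count⊇ B L              ≡⟨ count⊇-recurrence allw IH K⊆B ∣B∣≡j ⟩
      (n ∸ j) * (μ * (n′ C k))           ≡⟨ cong (_* (μ * (n′ C k))) n∸j≡1+n′ ⟩
      suc n′ * (μ * (n′ C k))             ≡⟨ m*[n*o]≡n*[m*o] (suc n′) μ (n′ C k) ⟩
      μ * (suc n′ * (n′ C k))             ≡⟨ cong (μ *_) ([k+1]*[n+1]C[k+1]≡[n+1]*nCk n′ k) ⟨
      μ * (suc k * (suc n′ C suc k))     ≡⟨ m*[n*o]≡n*[m*o] μ (suc k) (suc n′ C suc k) ⟩
      suc k * (μ * (suc n′ C suc k))     ≡⟨ cong (λ i → suc k * (μ * (i C suc k))) n∸j≡1+n′ ⟨
      suc k * (μ * ((n ∸ j) C suc k))   ∎)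
    where
    open ≡-Reasoning
    n′ = n ∸ suc j
    1+j+k≡w : suc j + k ≡ w
    1+j+k≡w = trans (sym (+-suc j k)) j+1+k≡w
    IH : Uniform K (suc j) (μ * (n′ C k)) L
    IH = uniform-binomial allw w≤n unif (suc j) k 1+j+k≡w
    w∸j≡1+k : w ∸ j ≡ suc k
    w∸j≡1+k = trans (cong (_∸ j) (sym j+1+k≡w)) (m+n∸m≡n j (suc k))
    n∸j≡1+n′ : n ∸ j ≡ suc n′
    n∸j≡1+n′ = +-∸-assoc 1 (≤-trans (subst (suc j ≤_) 1+j+k≡w (m≤m+n (suc j) k)) w≤n)

  count⊇-all : ∀ {B L} → All (λ y → B ⊆ σ y) L → count⊇ B L ≡ length L
  count⊇-all {B} B⊆σ = cong length (filter-all (λ y → B ⊆? σ y) B⊆σ)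

  count⊇-oversized : ∀ {w B L} → SupportsOfSize w L → w < ∣ B ∣ → count⊇ B L ≡ 0
  count⊇-oversized {w} {B} allw w<∣B∣ = cong length (filter-none (λ y → B ⊆? σ y) (All.map B⊈ allw))
    where
    B⊈ : ∀ {y} → ∣ σ y ∣ ≡ w → ¬ (B ⊆ σ y)
    B⊈ ∣σy∣≡w B⊆σy = <⇒≱ w<∣B∣ (subst (∣ B ∣ ≤_) ∣σy∣≡w (p⊆q⇒∣p∣≤∣q∣ B⊆σy))

  Avoiding : Fin n → List A → List A
  Avoiding a = filter (λ y → ¬? (a ∈? σ y))

  count⊇-split : ∀ a B L → count⊇ B L ≡ count⊇ B (Avoiding a L) + count⊇ (B ∪ ⁅ a ⁆) L
  count⊇-split a B L = trans (length-filter-split (λ y → B ⊆? σ y) (λ y → a ∈? σ y) L)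
    (cong (count⊇ B (Avoiding a L) +_)
      (trans (length-filter-filter (λ y → B ⊆? σ y) (λ y → a ∈? σ y) L)
        (cong length (filter-≐ _ (λ y → B ∪ ⁅ a ⁆ ⊆? σ y) (join , split) L))))
    where
    join : ∀ {y} → B ⊆ σ y × a ∈ σ y → B ∪ ⁅ a ⁆ ⊆ σ y
    join (B⊆σy , a∈σy) = p⊆q∧x∈q⇒p∪⁅x⁆⊆q B⊆σy a∈σy
    split : ∀ {y} → B ∪ ⁅ a ⁆ ⊆ σ y → B ⊆ σ y × a ∈ σ y
    split B∪a⊆σy = p∪⁅x⁆⊆q⇒p⊆q B∪a⊆σy , p∪⁅x⁆⊆q⇒x∈q B∪a⊆σy

  count⊇-avoiding : ∀ a B L → count⊇ B (Avoiding a L) ≡ count⊇ B L ∸ count⊇ (B ∪ ⁅ a ⁆) L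
  count⊇-avoiding a B L =
    trans (sym (m+n∸n≡m _ (count⊇ (B ∪ ⁅ a ⁆) L))) (cong (_∸ count⊇ (B ∪ ⁅ a ⁆) L) (sym (count⊇-split a B L)))

  uniform-avoiding : ∀ {K U j μ μ′ L} a → a ∈ U →
    UniformWithin K U j μ L → UniformWithin K U (suc j) μ′ L → UniformWithin K (U - a) j (μ ∸ μ′) (Avoiding a L)
  uniform-avoiding {K} {U} {j} {μ} {μ′} {L} a a∈U unif unif′ B K⊆B B⊆U-a ∣B∣≡j =
    trans (count⊇-avoiding a B L) (cong₂ _∸_ (unif B K⊆B B⊆U ∣B∣≡j) (unif′ (B ∪ ⁅ a ⁆) K⊆B∪a B∪a⊆U ∣B∪a∣≡1+j))
    where
    B⊆U : B ⊆ U
    B⊆U = p─q⊆p U ⁅ a ⁆ ∘ B⊆U-a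
    K⊆B∪a : K ⊆ B ∪ ⁅ a ⁆
    K⊆B∪a = p⊆p∪q ⁅ a ⁆ ∘ K⊆B
    B∪a⊆U : B ∪ ⁅ a ⁆ ⊆ U
    B∪a⊆U = p⊆q∧x∈q⇒p∪⁅x⁆⊆q B⊆U a∈U
    ∣B∪a∣≡1+j : ∣ B ∪ ⁅ a ⁆ ∣ ≡ suc j
    ∣B∪a∣≡1+j = trans (x∉p⇒∣p∪⁅x⁆∣≡1+∣p∣ (x∉p-x a U ∘ B⊆U-a)) (cong suc ∣B∣≡j)

  uniform-by-inclusion-exclusion : ∀ d {w K U L} (level : ℕ → ℕ) →
    All (λ y → ∣ σ y ∣ ≡ w × σ y ⊆ U) L → ∣ U ∣ ≡ w + d → K ⊆ U →
    (∀ j → ∣ K ∣ ≤ j → j ≤ ∣ K ∣ + d → UniformWithin K U j (level j) L) →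
    UniformWithin K U w (Δ^ d level ∣ K ∣) L
  uniform-by-inclusion-exclusion zero {w} {K} {U} {L} level supports ∣U∣≡w+0 K⊆U levels B K⊆B B⊆U _ = begin
    count⊇ B L    ≡⟨ count⊇-all (contained-in-all B⊆U) ⟩
    length L      ≡⟨ count⊇-all (contained-in-all K⊆U) ⟨
    count⊇ K L    ≡⟨ levels ∣ K ∣ ≤-refl (m≤m+n ∣ K ∣ 0) K ⊆-refl K⊆U refl ⟩
    level ∣ K ∣   ∎
    where
    open ≡-Reasoning
    σy≡U : ∀ {y} → ∣ σ y ∣ ≡ w × σ y ⊆ U → σ y ≡ U
    σy≡U (∣σy∣≡w , σy⊆U) = p⊆q∧∣q∣≤∣p∣⇒p≡q σy⊆U (≤-reflexive (trans ∣U∣≡w+0 (trans (+-identityʳ w) (sym ∣σy∣≡w))))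
    contained-in-all : ∀ {D} → D ⊆ U → All (λ y → D ⊆ σ y) L
    contained-in-all {D} D⊆U = All.map D⊆σ supports
      where
      D⊆σ : ∀ {y} → ∣ σ y ∣ ≡ w × σ y ⊆ U → D ⊆ σ y
      D⊆σ s x∈D = subst (_ ∈_) (sym (σy≡U s)) (D⊆U x∈D)
  uniform-by-inclusion-exclusion (suc d) {w} {K} {U} {L} level supports ∣U∣≡w+1+d K⊆U levels B K⊆B B⊆U ∣B∣≡w
    with ∣p∣<∣q∣⇒∃q∖p {p = B} {q = U} (subst₂ _<_ (sym ∣B∣≡w) (sym ∣U∣≡w+1+d) (m<m+n w (s≤s z≤n)))
  ... | a , a∈U , a∉B = begin
    count⊇ B L                                        ≡⟨ count⊇-split a B L ⟩
    count⊇ B (Avoiding a L) + count⊇ (B ∪ ⁅ a ⁆) L   ≡⟨ cong₂ _+_ IH (count⊇-oversized (All.map proj₁ supports) ∣B∪a∣>w) ⟩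
    Δ^ d (Δ level) ∣ K ∣ + 0                          ≡⟨ +-identityʳ _ ⟩
    Δ^ d (Δ level) ∣ K ∣                              ∎
    where
    open ≡-Reasoning
    ∣B∪a∣>w : w < ∣ B ∪ ⁅ a ⁆ ∣
    ∣B∪a∣>w = ≤-reflexive (sym (trans (x∉p⇒∣p∪⁅x⁆∣≡1+∣p∣ a∉B) (cong suc ∣B∣≡w)))
    avoiding-supports : All (λ y → ∣ σ y ∣ ≡ w × σ y ⊆ U - a) (Avoiding a L)
    avoiding-supports = All.map shrink (All.zip (filter⁺ _ supports , all-filter _ L))
      where
      shrink : ∀ {y} → (∣ σ y ∣ ≡ w × σ y ⊆ U) × ¬ (a ∈ σ y) → ∣ σ y ∣ ≡ w × σ y ⊆ U - a
      shrink ((∣σy∣≡w , σy⊆U) , a∉σy) = ∣σy∣≡w , p⊆q∧x∉p⇒p⊆q-x σy⊆U a∉σy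
    ∣U-a∣≡w+d : ∣ U - a ∣ ≡ w + d
    ∣U-a∣≡w+d = suc-injective (trans (x∈p⇒1+∣p-x∣≡∣p∣ a∈U) (trans ∣U∣≡w+1+d (+-suc w d)))
    avoiding-levels : ∀ j → ∣ K ∣ ≤ j → j ≤ ∣ K ∣ + d → UniformWithin K (U - a) j (Δ level j) (Avoiding a L)
    avoiding-levels j lo hi = uniform-avoiding {L = L} a a∈U
      (levels j lo (≤-trans hi (+-monoʳ-≤ ∣ K ∣ (n≤1+n d))))
      (levels (suc j) (≤-trans lo (n≤1+n j)) (≤-trans (s≤s hi) (≤-reflexive (sym (+-suc ∣ K ∣ d)))))
    IH = uniform-by-inclusion-exclusion d (Δ level) avoiding-supports ∣U-a∣≡w+d
      (p⊆q∧x∉p⇒p⊆q-x K⊆U (a∉B ∘ K⊆B)) avoiding-levels B K⊆B (p⊆q∧x∉p⇒p⊆q-x B⊆U a∉B) ∣B∣≡w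

  uniform-lift : ∀ {w r μ K L} → SupportsOfSize w L → r ≤ w → w ≤ n → ∣ K ∣ + (n ∸ w) ≤ r →
    Uniform K r μ L → Σ ℕ λ ν → ν * ((n ∸ r) C (w ∸ r)) ≡ μ × Uniform K w ν L
  uniform-lift {w} {r} {μ} {K} {L} allw r≤w w≤n ∣K∣+[n∸w]≤r unif = ν , ν*nCk≡μ , uniform-top
    where
    r≤n = ≤-trans r≤w w≤n
    grow : ℕ → Subset n
    grow j = enlarge (j ∸ ∣ K ∣) K
    ∣grow∣ : ∀ {j} → ∣ K ∣ ≤ j → j ≤ r → ∣ grow j ∣ ≡ j
    ∣grow∣ {j} ∣K∣≤j j≤r =
      trans (∣enlarge∣≡∣p∣+k (j ∸ ∣ K ∣) K (≤-trans (≤-reflexive (m+[n∸m]≡n ∣K∣≤j)) (≤-trans j≤r r≤n))) (m+[n∸m]≡n ∣K∣≤j)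
    level : ℕ → ℕ
    level j = count⊇ (grow j) L
    uniform-level : ∀ j → ∣ K ∣ ≤ j → j ≤ r → Uniform K j (level j) L
    uniform-level j ∣K∣≤j j≤r = subst (λ i → Uniform K i (level j) L) (∣grow∣ ∣K∣≤j j≤r)
      (uniform-below allw r≤w w≤n unif (grow j) (p⊆enlarge (j ∸ ∣ K ∣) K) (≤-trans (≤-reflexive (∣grow∣ ∣K∣≤j j≤r)) j≤r))
    ν = Δ^ (n ∸ w) level ∣ K ∣
    supports-within-⊤ : All (λ y → ∣ σ y ∣ ≡ w × σ y ⊆ ⊤) L
    supports-within-⊤ = All.map within-⊤ allw
      where
      within-⊤ : ∀ {y} → ∣ σ y ∣ ≡ w → ∣ σ y ∣ ≡ w × σ y ⊆ ⊤
      within-⊤ {y} ∣σy∣≡w = ∣σy∣≡w , ⊆-max (σ y)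
    uniform-top : Uniform K w ν L
    uniform-top B K⊆B = uniform-by-inclusion-exclusion (n ∸ w) level supports-within-⊤
      (trans (∣⊤∣≡n n) (sym (m+[n∸m]≡n w≤n))) (⊆-max K)
      (λ j lo hi B K⊆B _ → uniform-level j lo (≤-trans hi ∣K∣+[n∸w]≤r) B K⊆B) B K⊆B (⊆-max B)
    ∣K∣≤r = ≤-trans (m≤m+n ∣ K ∣ (n ∸ w)) ∣K∣+[n∸w]≤r
    ν*nCk≡μ : ν * ((n ∸ r) C (w ∸ r)) ≡ μ
    ν*nCk≡μ = trans (sym (uniform-binomial allw w≤n uniform-top r (w ∸ r) (m+[n∸m]≡n r≤w) (grow r) K⊆R ∣R∣≡r)) (unif (grow r) K⊆R ∣R∣≡r)
      where
      K⊆R = p⊆enlarge (r ∸ ∣ K ∣) K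
      ∣R∣≡r = ∣grow∣ ∣K∣≤r ≤-refl

m≡count⊇ : ∀ {n q s} (R S : Subset n) (ω : Vec (Fin q) s) Y →
  m R S Y ω ≡ SupersetCount.count⊇ support R (filter (matches? S ω) Y)
m≡count⊇ R S ω Y = sym (length-filter-filter (λ y → R ⊆? support y) (matches? S ω) Y)

design⇒m-uniform-on-w-sets : ∀ {q n w r s lam} {Y : List (Vec (Fin q) n)} → w ≤ n → s ≤ r → r ≤ w →
  All (InW w) Y → IsDesign w r s lam Y → n ∸ w ≤ r ∸ s →
  ∀ S ω → ∣ S ∣ ≡ s → NonZeroVec ω →
  Σ ℕ λ ν → ν * ((n ∸ r) C (w ∸ r)) ≡ lam × (∀ R → S ⊆ R → ∣ R ∣ ≡ w → m R S Y ω ≡ ν)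
design⇒m-uniform-on-w-sets {n = n} {w} {r} {s} {Y = Y} w≤n s≤r r≤w allY design n∸w≤r∸s S ω ∣S∣≡s ω≢0
  with uniform-lift (filter⁺ (matches? S ω) allY) r≤w w≤n ∣S∣+[n∸w]≤r
         (λ R S⊆R ∣R∣≡r → trans (sym (m≡count⊇ R S ω Y)) (design R S S⊆R ∣S∣≡s ∣R∣≡r ω ω≢0))
  where
  open SupersetCount support
  ∣S∣+[n∸w]≤r : ∣ S ∣ + (n ∸ w) ≤ r
  ∣S∣+[n∸w]≤r = subst (λ i → i + (n ∸ w) ≤ r) (sym ∣S∣≡s)
    (≤-trans (+-monoʳ-≤ s n∸w≤r∸s) (≤-reflexive (m+[n∸m]≡n s≤r)))
... | ν , ν*nCk≡lam , uniform = ν , ν*nCk≡lam , λ R S⊆R ∣R∣≡w → trans (m≡count⊇ R S ω Y) (uniform R S⊆R ∣R∣≡w)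

∃-nonzero-pattern : ∀ {q n s} → 2 ≤ q → s ≤ n →
  Σ (Subset n) λ S → ∣ S ∣ ≡ s × Σ (Vec (Fin q) s) NonZeroVec
∃-nonzero-pattern {suc (suc q)} {n} {s} (s≤s (s≤s z≤n)) s≤n = enlarge s ⊥ , ∣enlarge⊥∣≡s , replicate s (suc zero) , ones≢0
  where
  ∣enlarge⊥∣≡s : ∣ enlarge s ⊥ ∣ ≡ s
  ∣enlarge⊥∣≡s = trans (∣enlarge∣≡∣p∣+k s ⊥ (subst (λ i → i + s ≤ n) (sym (∣⊥∣≡0 n)) s≤n)) (cong (_+ s) (∣⊥∣≡0 n))
  ones≢0 : NonZeroVec (replicate {A = Fin (suc (suc q))} s (suc zero))
  ones≢0 j one≡0 with trans (sym (cong toℕ (lookup-replicate j (suc zero)))) one≡0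
  ... | ()

proposition4p6 : (q n w r s lam : ℕ) → 2 ≤ q → 1 ≤ n → w ≤ n → s ≤ r → r ≤ w →
    (Y : List (Vec (Fin q) n)) → Unique Y → All (InW w) Y →
    IsDesign w r s lam Y → n ∸ w ≤ r ∸ s →
    Σ ℕ (λ lam′ → lam′ * ((n ∸ r) C (w ∸ r)) ≡ lam × IsDesign w w s lam′ Y)
-- Y need not be duplicate-free: every count is taken with multiplicity.
proposition4p6 q n w r s lam 2≤q _ w≤n s≤r r≤w Y _ allY design n∸w≤r∸s =
  let (S₀ , ∣S₀∣≡s , ω₀ , ω₀≢0) = ∃-nonzero-pattern 2≤q (≤-trans s≤r (≤-trans r≤w w≤n))
      (lam′ , lam′*nCk≡lam , _) = lift S₀ ω₀ ∣S₀∣≡s ω₀≢0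
  in lam′ , lam′*nCk≡lam , λ R S S⊆R ∣S∣≡s ∣R∣≡w ω ω≢0 →
    let (ν , ν*nCk≡lam , m≡ν) = lift S ω ∣S∣≡s ω≢0
    in trans (m≡ν R S⊆R ∣R∣≡w) (*-cancelʳ-≡ ν lam′ nCk (trans ν*nCk≡lam (sym lam′*nCk≡lam)))
  where
  lift = design⇒m-uniform-on-w-sets w≤n s≤r r≤w allY design n∸w≤r∸s
  nCk = (n ∸ r) C (w ∸ r)
  instance
    nCk≢0 : NonZero nCk
    nCk≢0 = >-nonZero (k≤n⇒0<nCk (∸-monoˡ-≤ r w≤n))
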